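{- Let $S$ be a nonempty string, let $n_{\mathit{RL}}$ be the number of factors in the run-length factorization of $S$, and let $n_{\mathit{LZ}}$ be the number of factors in the s-factorization of $S$. Then $n_{\mathit{LZ}} \leq 2 n_{\mathit{RL}}$.
   Context: Strings are over a finite alphabet $\Sigma$; $S[i]$ is the $i$-th character and $S[i..j]$ the substring from position $i$ to $j$ (empty if $j<i$). For a character $a$ and integer $p\ge 1$, $a^p$ denotes $a$ repeated $p$ times. The run-length (RL) factorization of $S$ is the factorization $S=f_1\cdots f_n$ where each $f_i$ is the longest prefix of $f_i\cdots f_n$ of the form $a^p$ with $a\in\Sigma$, $p>0$ (so consecutive factors use different characters). The s-factorization of $S$ is $S=f_1\cdots f_m$ defined inductively: $f_1=S[1]$; for $i\ge2$, let $\ell=|f_1\cdots f_{i-1}|+1$ and $c=S[\ell]$; if $c$ does not occur in $f_1\cdots f_{i-1}$ then $f_i=c$; otherwise $f_i$ is the longest prefix of $f_i\cdots f_m$ (i.e. of $S[\ell..|S|]$) that occurs at least twice in $f_1\cdots f_i$ (occurrences may overlap). -}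

module Defs where

open import Data.Nat using (ℕ; suc; _≤_)
open import Data.List using (List; []; _∷_; _++_; concat; length; replicate)
open import Data.List.Membership.Propositional using (_∈_)
open import Data.Product using (Σ; ∃; ∃-syntax; _×_)
open import Relation.Binary.PropositionalEquality using (_≡_; _≢_)
open import Relation.Nullary using (¬_)

module _ {Σ' : Set} where

  IsPrefix : List Σ' → List Σ' → Set
  IsPrefix g T = ∃[ v ] (g ++ v ≡ T)

  OccursAt : List Σ' → List Σ' → ℕ → Set
  OccursAt g T i = ∃[ u ] ∃[ v ] (T ≡ u ++ g ++ v × length u ≡ i)

  -- g occurs at least twice in T (occurrences may overlap)
  OccursTwice : List Σ' → List Σ' → Set
  OccursTwice g T = ∃[ i ] ∃[ j ] (i ≢ j × OccursAt g T i × OccursAt g T j)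

  IsRLFactorization : List Σ' → List (List Σ') → Set
  IsRLFactorization S fs =
    concat fs ≡ S ×
    (∀ pre f post → fs ≡ pre ++ f ∷ post →
       (∃[ a ] ∃[ p ] (f ≡ replicate (suc p) a)) ×
       (∀ a' p' → IsPrefix (replicate (suc p') a') (concat (f ∷ post)) →
          suc p' ≤ length f))

  IsSFactorization : List Σ' → List (List Σ') → Set
  IsSFactorization S fs =
    concat fs ≡ S ×
    (∀ pre f post → fs ≡ pre ++ f ∷ post →
       ∃[ c ] ∃[ rest ] (concat (f ∷ post) ≡ c ∷ rest ×
         ((¬ (c ∈ concat pre) → f ≡ c ∷ []) ×
          (c ∈ concat pre →
             IsPrefix f (concat (f ∷ post)) ×
             OccursTwice f (concat pre ++ f) ×
             (∀ g → IsPrefix g (concat (f ∷ post)) →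
                OccursTwice g (concat pre ++ g) → length g ≤ length f)))))

-- Read S from left to right and charge each s-factor to the runs it touches.  Write
-- Φ(w, t) for twice the number of runs of t that do not continue the run ending w,
-- plus one if t does continue that run.  Every s-factor f decreases Φ(w, f t) by at
-- least one: if f reaches a new run this is clear, and otherwise f lies inside the run
-- ending w, so f cannot be followed by the same character, since the longer prefix
-- f c would also occur twice in w f c (shifted by one position) and contradict the
-- maximality of f.  Hence the number of s-factors is at most Φ([], S) = 2 n_RL.
module Submission where

open import Defs
open import Data.Nat using (ℕ; zero; suc; _+_; _*_; _≤_; z≤n; s≤s)
open import Data.Nat.Properties
  using (≤-refl; ≤-reflexive; +-identityʳ; +-comm; *-suc; +-monoʳ-≤; +-monoˡ-≤; *-monoʳ-≤;
         m≤m+n; n≤1+n; n≢0⇒n>0; m<m+n; <⇒≢; 1+n≰n; module ≤-Reasoning)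
import Data.Nat.Properties as ℕ
open import Data.Fin using (Fin)
open import Data.List using (List; []; _∷_; _++_; _∷ʳ_; length; concat; replicate; initLast; _∷ʳ′_)
open import Data.List.Properties using (++-assoc; ++-identityʳ; length-++; length-replicate; ∷-injectiveˡ)
open import Data.List.Membership.Propositional using (_∈_)
open import Data.List.Membership.Propositional.Properties using (∈-∃++; ∈-++⁺ʳ)
open import Data.List.Relation.Unary.All using (All; []; _∷_)
open import Data.List.Relation.Unary.Any using (here)
open import Data.Maybe using (Maybe; just; nothing)
open import Data.Product using (∃-syntax; _×_; _,_; proj₁)
open import Data.Empty using (⊥-elim)
open import Function using (case_of_)
open import Relation.Nullary using (¬_; yes; no)
open import Relation.Binary.Definitions using (DecidableEquality)
open import Relation.Binary.PropositionalEquality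
  using (_≡_; _≢_; refl; sym; trans; cong; cong₂; subst; subst₂; module ≡-Reasoning)

All-fromSplits : ∀ {A : Set} {P : A → Set} xs →
                 (∀ pre x post → xs ≡ pre ++ x ∷ post → P x) → All P xs
All-fromSplits []       _ = []
All-fromSplits (x ∷ xs) h =
  h [] x xs refl ∷ All-fromSplits xs (λ pre y post eq → h (x ∷ pre) y post (cong (x ∷_) eq))

module _ {A : Set} where

  replicate-shift : ∀ n (c : A) t → replicate n c ++ c ∷ t ≡ c ∷ replicate n c ++ t
  replicate-shift zero    c t = refl
  replicate-shift (suc n) c t = cong (c ∷_) (replicate-shift n c t)

  -- The Maybe A is the last character read so far, nothing at the start of the string.
  lastOr : Maybe A → List A → Maybe A
  lastOr m []       = m
  lastOr _ (y ∷ ys) = lastOr (just y) ys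

  lastOr-++ : ∀ m xs ys → lastOr m (xs ++ ys) ≡ lastOr (lastOr m xs) ys
  lastOr-++ m []       ys = refl
  lastOr-++ m (x ∷ xs) ys = lastOr-++ (just x) xs ys

  lastOr-replicate : ∀ n (c : A) → lastOr (just c) (replicate n c) ≡ just c
  lastOr-replicate zero    c = refl
  lastOr-replicate (suc n) c = lastOr-replicate n c

  length-≢-++-∷ : ∀ (u : List A) c v → length u ≢ length (u ++ c ∷ v)
  length-≢-++-∷ u c v eq = <⇒≢ (m<m+n (length u) (s≤s z≤n)) (trans eq (length-++ u))

  occursTwice-∈ : ∀ {c : A} {w} → c ∈ w → OccursTwice (c ∷ []) (w ++ c ∷ [])
  occursTwice-∈ {c} c∈w with ∈-∃++ c∈w
  ... | u , v , refl =
    length u , length (u ++ c ∷ v) , length-≢-++-∷ u c v ,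
    (u , v ++ c ∷ [] , ++-assoc u (c ∷ v) (c ∷ []) , refl) ,
    (u ++ c ∷ v , [] , refl , refl)

  occursTwice-replicate : ∀ (u : List A) c n → OccursTwice (replicate n c) (u ++ replicate (suc n) c)
  occursTwice-replicate u c n =
    length u , length (u ∷ʳ c) , length-≢-++-∷ u c [] ,
    (u , c ∷ [] , cong (u ++_) (sym first) , refl) ,
    (u ∷ʳ c , [] , second , refl)
    where
    first : replicate n c ∷ʳ c ≡ replicate (suc n) c
    first = trans (replicate-shift n c []) (cong (c ∷_) (++-identityʳ _))
    second : u ++ replicate (suc n) c ≡ (u ∷ʳ c) ++ replicate n c ++ []
    second = trans (cong (λ x → u ++ c ∷ x) (sym (++-identityʳ _))) (sym (++-assoc u (c ∷ []) _))

  -- The condition IsSFactorization imposes on a factor f preceded by w and followed by t;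
  -- the second component of IsSFactorization S lz is SFactorsAfter [] lz.
  SFactorAt : List A → List A → List A → Set
  SFactorAt w f t =
    ∃[ c ] ∃[ rest ] (f ++ t ≡ c ∷ rest ×
      ((¬ (c ∈ w) → f ≡ c ∷ []) ×
       (c ∈ w →
          IsPrefix f (f ++ t) × OccursTwice f (w ++ f) ×
          (∀ g → IsPrefix g (f ++ t) → OccursTwice g (w ++ g) → length g ≤ length f))))

  SFactorsAfter : List A → List (List A) → Set
  SFactorsAfter w fs =
    ∀ pre f post → fs ≡ pre ++ f ∷ post → SFactorAt (w ++ concat pre) f (concat post)

  SFactorsAfter-∷ : ∀ {w f fs} → SFactorsAfter w (f ∷ fs) →
                    SFactorAt w f (concat fs) × SFactorsAfter (w ++ f) fs
  SFactorsAfter-∷ {w} {f} {fs} h =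
    subst (λ x → SFactorAt x f (concat fs)) (++-identityʳ w) (h [] f fs refl) , tail
    where
    tail : SFactorsAfter (w ++ f) fs
    tail pre g post eq =
      subst (λ x → SFactorAt x g (concat post)) (sym (++-assoc w f (concat pre)))
        (h (f ∷ pre) g post (cong (f ∷_) eq))

  ¬SFactorAt-[] : ∀ {w t} → ¬ SFactorAt w [] t
  ¬SFactorAt-[] {w} (c , rest , t≡c∷rest , fresh , repeated) = case fresh c∉w of λ ()
    where
    c∉w : ¬ c ∈ w
    c∉w c∈w with _ , _ , maximal ← repeated c∈w =
      case maximal (c ∷ []) (rest , sym t≡c∷rest) (occursTwice-∈ c∈w) of λ ()

  ¬SFactorAt-run : ∀ w (c : A) n t → ¬ SFactorAt (w ∷ʳ c) (replicate n c) (c ∷ t)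
  ¬SFactorAt-run w c n t (_ , _ , eq , _ , repeated)
    with refl ← ∷-injectiveˡ (trans (sym (replicate-shift n c t)) eq)
    with _ , _ , maximal ← repeated (∈-++⁺ʳ w (here refl)) =
    1+n≰n (subst₂ _≤_ (length-replicate (suc n)) (length-replicate n) (maximal g prefix occurs))
    where
    g = replicate (suc n) c
    prefix : IsPrefix g (replicate n c ++ c ∷ t)
    prefix = t , sym (replicate-shift n c t)
    occurs : OccursTwice g ((w ∷ʳ c) ++ g)
    occurs = subst (OccursTwice g) (sym (++-assoc w (c ∷ []) g)) (occursTwice-replicate w c (suc n))

module Runs {A : Set} (_≟_ : DecidableEquality A) where

  runsAfter : Maybe A → List A → ℕ
  runsAfter _        []       = 0
  runsAfter nothing  (y ∷ ys) = suc (runsAfter (just y) ys)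
  runsAfter (just x) (y ∷ ys) with x ≟ y
  ... | yes _ = runsAfter (just y) ys
  ... | no _  = suc (runsAfter (just y) ys)

  runs : List A → ℕ
  runs = runsAfter nothing

  continues : Maybe A → List A → ℕ
  continues nothing  _        = 0
  continues (just x) []       = 0
  continues (just x) (y ∷ _) with x ≟ y
  ... | yes _ = 1
  ... | no _  = 0

  runsAfter-++ : ∀ m xs ys → runsAfter m (xs ++ ys) ≡ runsAfter m xs + runsAfter (lastOr m xs) ys
  runsAfter-++ m        []       zs = refl
  runsAfter-++ nothing  (y ∷ ys) zs = cong suc (runsAfter-++ (just y) ys zs)
  runsAfter-++ (just x) (y ∷ ys) zs with x ≟ y
  ... | yes _ = runsAfter-++ (just y) ys zs
  ... | no _  = cong suc (runsAfter-++ (just y) ys zs)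

  runsAfter-replicate : ∀ n c t → runsAfter (just c) (replicate n c ++ t) ≡ runsAfter (just c) t
  runsAfter-replicate zero    c t = refl
  runsAfter-replicate (suc n) c t with c ≟ c
  ... | yes _  = runsAfter-replicate n c t
  ... | no c≢c = ⊥-elim (c≢c refl)

  runsAfter≡0⇒replicate : ∀ c xs → runsAfter (just c) xs ≡ 0 → ∃[ n ] xs ≡ replicate n c
  runsAfter≡0⇒replicate c []       _ = 0 , refl
  runsAfter≡0⇒replicate c (y ∷ ys) eq with c ≟ y
  ... | yes refl = let n , ys≡ = runsAfter≡0⇒replicate c ys eq in suc n , cong (c ∷_) ys≡

  runsAfter≤runs : ∀ m xs → runsAfter m xs ≤ runs xs
  runsAfter≤runs nothing  xs       = ≤-refl
  runsAfter≤runs (just x) []       = z≤n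
  runsAfter≤runs (just x) (y ∷ ys) with x ≟ y
  ... | yes _ = n≤1+n _
  ... | no _  = ≤-refl

  continues≤1 : ∀ m t → continues m t ≤ 1
  continues≤1 nothing  _       = z≤n
  continues≤1 (just x) []      = z≤n
  continues≤1 (just x) (y ∷ _) with x ≟ y
  ... | yes _ = ≤-refl
  ... | no _  = z≤n

  continues-∷ : ∀ c t → continues (just c) (c ∷ t) ≡ 1
  continues-∷ c t with c ≟ c
  ... | yes _  = refl
  ... | no c≢c = ⊥-elim (c≢c refl)

  IsRun : List A → Set
  IsRun f = ∃[ a ] ∃[ p ] (f ≡ replicate (suc p) a)

  runs-concat≤length : ∀ {fs} → All IsRun fs → runs (concat fs) ≤ length fs
  runs-concat≤length []                                    = z≤n
  runs-concat≤length {fs = _ ∷ fs} ((a , p , refl) ∷ rest) = s≤s (begin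
    runsAfter (just a) (replicate p a ++ concat fs) ≡⟨ runsAfter-replicate p a (concat fs) ⟩
    runsAfter (just a) (concat fs)                  ≤⟨ runsAfter≤runs (just a) (concat fs) ⟩
    runs (concat fs)                                ≤⟨ runs-concat≤length rest ⟩
    length fs                                       ∎)
    where open ≤-Reasoning

  potential : Maybe A → List A → ℕ
  potential m t = 2 * runsAfter m t + continues m t

  potential-newRun : ∀ m xs t → runsAfter m xs ≢ 0 →
                     suc (potential (lastOr m xs) t) ≤ potential m (xs ++ t)
  potential-newRun m xs t new = begin
    suc (2 * r + continues (lastOr m xs) t) ≤⟨ s≤s (+-monoʳ-≤ (2 * r) (continues≤1 (lastOr m xs) t)) ⟩
    suc (2 * r + 1)                         ≡⟨ cong suc (+-comm (2 * r) 1) ⟩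
    2 + 2 * r                               ≡⟨ *-suc 2 r ⟨
    2 * suc r                               ≤⟨ *-monoʳ-≤ 2 (+-monoˡ-≤ r (n≢0⇒n>0 new)) ⟩
    2 * (runsAfter m xs + r)                ≡⟨ cong (2 *_) (runsAfter-++ m xs t) ⟨
    2 * runsAfter m (xs ++ t)               ≤⟨ m≤m+n _ (continues m (xs ++ t)) ⟩
    potential m (xs ++ t)                   ∎
    where
    open ≤-Reasoning
    r = runsAfter (lastOr m xs) t

  potential-sameRun : ∀ n c t → continues (just c) t ≡ 0 →
                      potential (just c) (replicate (suc n) c ++ t) ≡ suc (potential (just c) t)
  potential-sameRun n c t stop = begin
    2 * runsAfter (just c) (replicate (suc n) c ++ t) + continues (just c) (c ∷ replicate n c ++ t)
      ≡⟨ cong₂ (λ x y → 2 * x + y) (runsAfter-replicate (suc n) c t)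
               (continues-∷ c (replicate n c ++ t)) ⟩
    2 * r + 1                     ≡⟨ +-comm (2 * r) 1 ⟩
    suc (2 * r)                   ≡⟨ cong suc (+-identityʳ (2 * r)) ⟨
    suc (2 * r + 0)               ≡⟨ cong (λ x → suc (2 * r + x)) stop ⟨
    suc (potential (just c) t)    ∎
    where
    open ≡-Reasoning
    r = runsAfter (just c) t

  continues-≢ : ∀ c t → (∀ t′ → t ≢ c ∷ t′) → continues (just c) t ≡ 0
  continues-≢ c []      _    = refl
  continues-≢ c (y ∷ t) t≢c∷ with c ≟ y
  ... | yes refl = ⊥-elim (t≢c∷ t refl)
  ... | no _     = refl

  potential-step : ∀ {w f t} → SFactorAt w f t →
                   suc (potential (lastOr (lastOr nothing w) f) t) ≤ potential (lastOr nothing w) (f ++ t)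
  potential-step {f = []} sf = ⊥-elim (¬SFactorAt-[] sf)
  potential-step {w} {f@(_ ∷ _)} {t} sf with initLast w
  ... | [] = potential-newRun nothing f t (λ ())
  ... | w₀ ∷ʳ′ c rewrite lastOr-++ nothing w₀ (c ∷ []) with runsAfter (just c) f ℕ.≟ 0
  ...   | no new = potential-newRun (just c) f t new
  ...   | yes same with runsAfter≡0⇒replicate c f same
  ...     | suc n , refl rewrite lastOr-replicate (suc n) c =
    ≤-reflexive (sym (potential-sameRun n c t (continues-≢ c t (λ t′ t≡c∷t′ →
      ¬SFactorAt-run w₀ c (suc n) t′ (subst (SFactorAt _ _) t≡c∷t′ sf)))))

  length≤potential : ∀ w fs → SFactorsAfter w fs →
                     length fs ≤ potential (lastOr nothing w) (concat fs)
  length≤potential w []       _ = z≤n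
  length≤potential w (f ∷ fs) h with hf , hfs ← SFactorsAfter-∷ h = begin
    suc (length fs)
      ≤⟨ s≤s (length≤potential (w ++ f) fs hfs) ⟩
    suc (potential (lastOr nothing (w ++ f)) (concat fs))
      ≡⟨ cong (λ m → suc (potential m (concat fs))) (lastOr-++ nothing w f) ⟩
    suc (potential (lastOr (lastOr nothing w) f) (concat fs))
      ≤⟨ potential-step hf ⟩
    potential (lastOr nothing w) (f ++ concat fs) ∎
    where open ≤-Reasoning

lemma1 : (k : ℕ) (S : List (Fin k)) → S ≢ [] →
         (rl lz : List (List (Fin k))) →
         IsRLFactorization S rl → IsSFactorization S lz →
         length lz ≤ 2 * length rl
lemma1 k S _ rl lz (rl-concat , rl-runs) (lz-concat , lz-factors) = begin
  length lz                     ≤⟨ length≤potential [] lz lz-factors ⟩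
  2 * runs (concat lz) + 0      ≡⟨ +-identityʳ _ ⟩
  2 * runs (concat lz)          ≡⟨ cong (λ x → 2 * runs x) (trans lz-concat (sym rl-concat)) ⟩
  2 * runs (concat rl)          ≤⟨ *-monoʳ-≤ 2 (runs-concat≤length (All-fromSplits rl blocks)) ⟩
  2 * length rl                 ∎
  where
  open ≤-Reasoning
  open Runs (Data.Fin._≟_ {k})
  blocks : ∀ pre f post → rl ≡ pre ++ f ∷ post → IsRun f
  blocks pre f post eq = proj₁ (rl-runs pre f post eq)
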